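{- There is a constant $C>0$ such that every plane $3$-tree $G$ with depth $k$ admits a planar straight-line drawing respecting its plane embedding whose edge-length ratio is at most $C\cdot k$; i.e., every plane $3$-tree with depth $k$ has planar edge-length ratio in $O(k)$.
   Context: For a straight-line drawing $\Gamma$ of a graph $G$, the edge-length ratio is $\rho(\Gamma)=\max_{e_1,e_2\in E(G)} \ell_\Gamma(e_1)/\ell_\Gamma(e_2)$, where $\ell_\Gamma(e)$ is the Euclidean length of the segment representing $e$; the planar edge-length ratio of a plane graph is the minimum of $\rho(\Gamma)$ over planar straight-line drawings $\Gamma$ respecting its prescribed plane embedding. A plane $3$-tree is defined recursively: the only plane $3$-tree with $3$ vertices is a $3$-cycle embedded in the plane; for $n\geq 4$, an $n$-vertex plane $3$-tree is obtained from an $(n-1)$-vertex plane $3$-tree $G'$ by inserting a vertex $v$ inside an internal face $f$ of $G'$ and connecting $v$ to the three vertices of $f$. The representative tree $T_G$ of a plane $3$-tree $G$ is a rooted ternary tree defined as follows: if $G$ has $3$ vertices, $T_G$ is a single node representing the unique internal face; otherwise, with $G$ obtained from $G'$ by inserting $v$ into face $f$, and $t_f$ the leaf of $T_{G'}$ representing $f$, $T_G$ is obtained from $T_{G'}$ by adding three leaves as children of $t_f$ (then $t_f$ represents $v$ and its children represent the three faces of $G$ incident to $v$). The depth of $T_G$ is the maximum number of nodes on a root-to-leaf path; the depth of $G$ is the depth of $T_G$. -}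

module Defs where

open import Data.Nat using (ℕ; suc; _⊔_)
open import Data.Integer using (+_)
open import Data.Rational using (ℚ; _+_; _*_; _-_; _≤_; _<_; 0ℚ; _/_)
open import Data.Product using (_×_; _,_)
open import Data.Sum using (_⊎_)
open import Data.Unit using (⊤)
open import Data.List using (List; []; _∷_; _++_)
open import Data.List.Relation.Unary.All using (All)

-- A plane 3-tree (as a plane graph,
-- up to isomorphism of plane graphs) is determined by its construction; we
-- encode it by its representative ternary tree:
--   leaf             : an internal face into which nothing is inserted
--   node t₁ t₂ t₃    : a vertex v inserted into the face (a,b,c); the children
--                      represent the faces (a,b,v), (b,c,v), (c,a,v).
-- The root represents the unique internal face of the initial 3-cycle.
data T3 : Set where
  leaf : T3
  node : T3 → T3 → T3 → T3

depth : T3 → ℕ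
depth leaf = 1
depth (node t₁ t₂ t₃) = suc (depth t₁ ⊔ (depth t₂ ⊔ depth t₃))

Point : Set
Point = ℚ × ℚ

Placement : T3 → Set
Placement leaf = ⊤
Placement (node t₁ t₂ t₃) = Point × Placement t₁ × Placement t₂ × Placement t₃

-- twice the signed area of the triangle pqr
orient : Point → Point → Point → ℚ
orient (px , py) (qx , qy) (rx , ry) =
  ((qx - px) * (ry - py)) - ((qy - py) * (rx - px))

NonDegenerate : Point → Point → Point → Set
NonDegenerate a b c = (0ℚ < orient a b c) ⊎ (orient a b c < 0ℚ)

StrictlyInside : Point → Point → Point → Point → Set
StrictlyInside p a b c =
  ((0ℚ < orient a b p) × (0ℚ < orient b c p) × (0ℚ < orient c a p))
  ⊎ ((orient a b p < 0ℚ) × (orient b c p < 0ℚ) × (orient c a p < 0ℚ))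

-- Straight-line drawing of the part of the plane 3-tree inside face (a,b,c)
-- is planar and respects the embedding: every inserted vertex is drawn
-- strictly inside the triangle of the face it is inserted into.
Valid : Point → Point → Point → (t : T3) → Placement t → Set
Valid a b c leaf _ = ⊤
Valid a b c (node t₁ t₂ t₃) (p , d₁ , d₂ , d₃) =
  StrictlyInside p a b c × Valid a b p t₁ d₁ × Valid b c p t₂ d₂ × Valid c a p t₃ d₃

innerEdges : Point → Point → Point → (t : T3) → Placement t → List (Point × Point)
innerEdges a b c leaf _ = []
innerEdges a b c (node t₁ t₂ t₃) (p , d₁ , d₂ , d₃) =
  (a , p) ∷ (b , p) ∷ (c , p) ∷
    (innerEdges a b p t₁ d₁ ++ innerEdges b c p t₂ d₂ ++ innerEdges c a p t₃ d₃)

edges : Point → Point → Point → (t : T3) → Placement t → List (Point × Point)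
edges a b c t d = (a , b) ∷ (b , c) ∷ (c , a) ∷ innerEdges a b c t d

sqLen : Point × Point → ℚ
sqLen ((px , py) , (qx , qy)) = ((qx - px) * (qx - px)) + ((qy - py) * (qy - py))

-- edge-length ratio ≤ r, i.e. ℓ(e₁) ≤ r·ℓ(e₂) for all edges e₁ e₂,
-- expressed with squared lengths: ℓ(e₁)² ≤ r²·ℓ(e₂)²  (r ≥ 0)
RatioAtMost : ℚ → List (Point × Point) → Set
RatioAtMost r es = All (λ e₁ → All (λ e₂ → sqLen e₁ ≤ (r * r) * sqLen e₂) es) es

ℕtoℚ : ℕ → ℚ
ℕtoℚ k = (+ k) / 1

{-# OPTIONS --safe #-}
-- Draw the outer face with apex (0, 0) and its other corners at (k + 1, 1) and (k + 1, 0),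
-- where k is the depth, so that every vertex lies in the strip 0 ≤ y ≤ 1.  Every face is kept
-- a wedge: seen from one corner (its apex), the other two lie on the same side at integer
-- horizontal distances exceeding the depth still to be drawn inside the face.  A vertex inserted
-- into a wedge goes on the median from the apex, at horizontal distance 1 from it; the three new
-- faces are wedges again, with distances decreased by at most one.  Hence every edge spans an
-- integer horizontal distance in [1, k + 1] and a vertical distance at most 1, so its squared
-- length lies in [1, (k + 1)² + 1], and the edge-length ratio is at most 3k.
module Submission where

open import Defs
open import Data.Unit using (tt)
open import Data.Nat as ℕ using (ℕ; suc; s≤s; z≤n)
import Data.Nat.Properties as ℕP
import Data.Nat.Coprimality as Coprimality
import Data.Integer as ℤ
import Data.Integer.Properties as ℤP
open import Data.Rational
open import Data.Rational.Properties
open import Data.Product using (Σ; _×_; _,_; proj₁; proj₂)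
open import Data.Sum using (_⊎_; inj₁; inj₂)
open import Data.List using ([]; _∷_)
open import Data.List.Relation.Unary.All as All using (All; []; _∷_)
open import Data.List.Relation.Unary.All.Properties using (++⁺)
open import Relation.Binary.PropositionalEquality
open import Data.Rational.Solver using (module +-*-Solver)
open +-*-Solver

p≤q⇒0≤q-p : ∀ {p q} → p ≤ q → 0ℚ ≤ q - p
p≤q⇒0≤q-p {p} {q} p≤q = subst (_≤ q - p) (+-inverseʳ p) (+-monoˡ-≤ (- p) p≤q)

0≤q-p⇒p≤q : ∀ {q p} → 0ℚ ≤ q - p → p ≤ q
0≤q-p⇒p≤q {q} {p} 0≤q-p = subst₂ _≤_ (+-identityˡ p) (q-p+p≡q q p) (+-monoˡ-≤ p 0≤q-p)
  where
  q-p+p≡q : ∀ q p → q - p + p ≡ q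
  q-p+p≡q = solve 2 (λ q p → q :- p :+ p := q) refl

0≤1 : 0ℚ ≤ 1ℚ
0≤1 = nonNegative⁻¹ 1ℚ

p≤p+q : ∀ {q p} → 0ℚ ≤ q → p ≤ p + q
p≤p+q {q} {p} 0≤q = subst (_≤ p + q) (+-identityʳ p) (+-monoʳ-≤ p 0≤q)

nonNeg+nonNeg : ∀ {p q} → 0ℚ ≤ p → 0ℚ ≤ q → 0ℚ ≤ p + q
nonNeg+nonNeg = +-mono-≤

pos+pos : ∀ {p q} → 0ℚ < p → 0ℚ < q → 0ℚ < p + q
pos+pos = +-mono-<

nonNeg*nonNeg : ∀ {p q} → 0ℚ ≤ p → 0ℚ ≤ q → 0ℚ ≤ p * q
nonNeg*nonNeg {p} {q} 0≤p 0≤q =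
  nonNegative⁻¹ _ {{nonNeg*nonNeg⇒nonNeg p {{nonNegative 0≤p}} q {{nonNegative 0≤q}}}}

pos*pos : ∀ {p q} → 0ℚ < p → 0ℚ < q → 0ℚ < p * q
pos*pos {p} {q} 0<p 0<q = positive⁻¹ _ {{pos*pos⇒pos p {{positive 0<p}} q {{positive 0<q}}}}

pos*neg : ∀ {p q} → 0ℚ < p → q < 0ℚ → p * q < 0ℚ
pos*neg {p} {q} 0<p q<0 = negative⁻¹ _ {{pos*neg⇒neg p {{positive 0<p}} q {{negative q<0}}}}

-- despite its name, the library's nonPos*nonPos⇒nonPos concludes NonNegative
0≤p*p : ∀ p → 0ℚ ≤ p * p
0≤p*p p with ≤-total 0ℚ p
... | inj₁ 0≤p = nonNeg*nonNeg 0≤p 0≤p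
... | inj₂ p≤0 = nonNegative⁻¹ _ {{nonPos*nonPos⇒nonPos p {{nonPositive p≤0}} p {{nonPositive p≤0}}}}

square-mono-≤ : ∀ {p q} → 0ℚ ≤ p → p ≤ q → p * p ≤ q * q
square-mono-≤ {p} {q} 0≤p p≤q = ≤-trans
  (*-monoˡ-≤-nonNeg p {{nonNegative 0≤p}} p≤q)
  (*-monoʳ-≤-nonNeg q {{nonNegative (≤-trans 0≤p p≤q)}} p≤q)

ℕtoℚ≡mkℚ : ∀ n → ℕtoℚ n ≡ mkℚ (ℤ.+ n) 0 (Coprimality.sym (Coprimality.1-coprimeTo n))
ℕtoℚ≡mkℚ n = normalize-coprime (Coprimality.sym (Coprimality.1-coprimeTo n))

ℕtoℚ-mono-≤ : ∀ {m n} → m ℕ.≤ n → ℕtoℚ m ≤ ℕtoℚ n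
ℕtoℚ-mono-≤ {m} {n} m≤n rewrite ℕtoℚ≡mkℚ m | ℕtoℚ≡mkℚ n =
  *≤* (ℤP.*-monoʳ-≤-nonNeg (ℤ.+ 1) (ℤ.+≤+ m≤n))

ℕtoℚ-mono-< : ∀ {m n} → m ℕ.< n → ℕtoℚ m < ℕtoℚ n
ℕtoℚ-mono-< {m} {n} m<n rewrite ℕtoℚ≡mkℚ m | ℕtoℚ≡mkℚ n =
  *<* (ℤP.*-monoʳ-<-pos (ℤ.+ 1) (ℤ.+<+ m<n))

ℕtoℚ-suc : ∀ n → ℕtoℚ (suc n) ≡ 1ℚ + ℕtoℚ n
ℕtoℚ-suc n rewrite ℕtoℚ≡mkℚ n =
  cong (λ z → (ℤ.+ 1 ℤ.+ z) / 1) (sym (ℤP.*-identityʳ (ℤ.+ n)))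

0≤ℕtoℚ : ∀ n → 0ℚ ≤ ℕtoℚ n
0≤ℕtoℚ n = ℕtoℚ-mono-≤ {0} {n} z≤n

0<ℕtoℚ-suc : ∀ n → 0ℚ < ℕtoℚ (suc n)
0<ℕtoℚ-suc n = ℕtoℚ-mono-< {0} {suc n} (s≤s z≤n)

SqLenBetween : ℚ → ℚ → Point × Point → Set
SqLenBetween m M e = m ≤ sqLen e × sqLen e ≤ M

ratioAtMost : ∀ {m M} r {es} → M ≤ (r * r) * m → All (SqLenBetween m M) es → RatioAtMost r es
ratioAtMost r M≤r²m bounds = All.map
  (λ (_ , e₁≤M) → All.map
    (λ (m≤e₂ , _) → ≤-trans e₁≤M (≤-trans M≤r²m (*-monoˡ-≤-nonNeg (r * r) {{nonNegative (0≤p*p r)}} m≤e₂)))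
    bounds)
  bounds

record InStrip (q : Point) : Set where
  constructor inStrip
  field
    0≤y : 0ℚ ≤ proj₂ q
    y≤1 : proj₂ q ≤ 1ℚ

record Offset (s : ℚ) (D : ℕ) (q r : Point) : Set where
  constructor offset
  field
    x-offset : proj₁ r ≡ proj₁ q + s * ℕtoℚ D

offset-sym : ∀ {s D q r} → Offset s D q r → Offset (- s) D r q
offset-sym {s} {D} {qx , _} {_ , _} (offset refl) = offset (identity qx s (ℕtoℚ D))
  where
  identity : ∀ qx s d → qx ≡ (qx + s * d) + (- s) * d
  identity = solve 3 (λ qx s d → qx := (qx :+ s :* d) :+ (:- s) :* d) refl

offset-pred : ∀ {s D q p r} → Offset s (suc D) q r → Offset s 1 q p → Offset s D p r
offset-pred {s} {D} {qx , _} {_ , _} {_ , _} (offset refl) (offset refl) =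
  offset (trans (cong (λ z → qx + s * z) (ℕtoℚ-suc D)) (identity qx s (ℕtoℚ D)))
  where
  identity : ∀ qx s d → qx + s * (1ℚ + d) ≡ (qx + s * 1ℚ) + s * d
  identity = solve 3 (λ qx s d → qx :+ s :* (con 1ℚ :+ d) := (qx :+ s :* con 1ℚ) :+ s :* d) refl

Moderate : ℕ → Point × Point → Set
Moderate W = SqLenBetween 1ℚ (ℕtoℚ W * ℕtoℚ W + 1ℚ)

sqLen-offset : ∀ {s D q r} → s * s ≡ 1ℚ → Offset s D q r →
  sqLen (q , r) ≡ ℕtoℚ D * ℕtoℚ D + (proj₂ r - proj₂ q) * (proj₂ r - proj₂ q)
sqLen-offset {s} {D} {qx , qy} {_ , ry} s²≡1 (offset refl) = begin
  (qx + s * d - qx) * (qx + s * d - qx) + (ry - qy) * (ry - qy)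
    ≡⟨ identity qx s d (ry - qy) ⟩
  (s * s) * (d * d) + (ry - qy) * (ry - qy)
    ≡⟨ cong (λ z → z * (d * d) + (ry - qy) * (ry - qy)) s²≡1 ⟩
  1ℚ * (d * d) + (ry - qy) * (ry - qy)
    ≡⟨ cong (_+ (ry - qy) * (ry - qy)) (*-identityˡ (d * d)) ⟩
  d * d + (ry - qy) * (ry - qy) ∎
  where
  open ≡-Reasoning
  d = ℕtoℚ D
  identity : ∀ qx s d g → (qx + s * d - qx) * (qx + s * d - qx) + g * g ≡ (s * s) * (d * d) + g * g
  identity = solve 4 (λ qx s d g → (qx :+ s :* d :- qx) :* (qx :+ s :* d :- qx) :+ g :* g
                                  := (s :* s) :* (d :* d) :+ g :* g) refl

gap²≤1 : ∀ {q r} → InStrip q → InStrip r → (proj₂ r - proj₂ q) * (proj₂ r - proj₂ q) ≤ 1ℚ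
gap²≤1 {_ , qy} {_ , ry} (inStrip 0≤qy qy≤1) (inStrip 0≤ry ry≤1) = 0≤q-p⇒p≤q (subst (0ℚ ≤_) (sym (identity qy ry))
  (nonNeg*nonNeg (nonNeg+nonNeg (p≤q⇒0≤q-p ry≤1) 0≤qy) (nonNeg+nonNeg (p≤q⇒0≤q-p qy≤1) 0≤ry)))
  where
  identity : ∀ q r → 1ℚ - (r - q) * (r - q) ≡ ((1ℚ - r) + q) * ((1ℚ - q) + r)
  identity = solve 2 (λ q r → con 1ℚ :- (r :- q) :* (r :- q)
                             := ((con 1ℚ :- r) :+ q) :* ((con 1ℚ :- q) :+ r)) refl

offset-moderate : ∀ {s D W q r} → s * s ≡ 1ℚ → 1 ℕ.≤ D → D ℕ.≤ W → Offset s D q r →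
  InStrip q → InStrip r → Moderate W (q , r)
offset-moderate {s} {D} {W} {q} {r} s²≡1 1≤D D≤W q→r q-strip r-strip
  rewrite sqLen-offset {s} {D} {q} {r} s²≡1 q→r =
    ≤-trans (square-mono-≤ 0≤1 1≤d) (p≤p+q (0≤p*p gap))
  , +-mono-≤ (square-mono-≤ (≤-trans 0≤1 1≤d) d≤w) (gap²≤1 {q} {r} q-strip r-strip)
  where
  gap = proj₂ r - proj₂ q
  1≤d : 1ℚ ≤ ℕtoℚ D
  1≤d = ℕtoℚ-mono-≤ 1≤D
  d≤w : ℕtoℚ D ≤ ℕtoℚ W
  d≤w = ℕtoℚ-mono-≤ D≤W

barycentric : Point → Point → Point → ℚ → ℚ → Point
barycentric (vx , vy) (ux , uy) (wx , wy) α β =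
  vx + α * (ux - vx) + β * (wx - vx) , vy + α * (uy - vy) + β * (wy - vy)

module _ {n : ℕ} where
  orientₑ : Polynomial n × Polynomial n → Polynomial n × Polynomial n → Polynomial n × Polynomial n → Polynomial n
  orientₑ (px , py) (qx , qy) (rx , ry) = (qx :- px) :* (ry :- py) :- (qy :- py) :* (rx :- px)

  barycentricₑ : Polynomial n × Polynomial n → Polynomial n × Polynomial n → Polynomial n × Polynomial n →
    Polynomial n → Polynomial n → Polynomial n × Polynomial n
  barycentricₑ (vx , vy) (ux , uy) (wx , wy) α β =
    vx :+ α :* (ux :- vx) :+ β :* (wx :- vx) , vy :+ α :* (uy :- vy) :+ β :* (wy :- vy)

orient-barycentric : ∀ u w v α β → let p = barycentric v u w α β; O = orient u w v in
  orient u w p ≡ (1ℚ - α - β) * O × orient w v p ≡ α * O × orient v u p ≡ β * O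
orient-barycentric (ux , uy) (wx , wy) (vx , vy) α β =
    solve 8 (λ ux uy wx wy vx vy α β → let u = ux , uy; w = wx , wy; v = vx , vy in
      orientₑ u w (barycentricₑ v u w α β) := (con 1ℚ :- α :- β) :* orientₑ u w v) refl ux uy wx wy vx vy α β
  , solve 8 (λ ux uy wx wy vx vy α β → let u = ux , uy; w = wx , wy; v = vx , vy in
      orientₑ w v (barycentricₑ v u w α β) := α :* orientₑ u w v) refl ux uy wx wy vx vy α β
  , solve 8 (λ ux uy wx wy vx vy α β → let u = ux , uy; w = wx , wy; v = vx , vy in
      orientₑ v u (barycentricₑ v u w α β) := β :* orientₑ u w v) refl ux uy wx wy vx vy α β

barycentric-strictlyInside : ∀ {α β u w v} → 0ℚ < 1ℚ - α - β → 0ℚ < α → 0ℚ < β →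
  NonDegenerate u w v → StrictlyInside (barycentric v u w α β) u w v
barycentric-strictlyInside {α} {β} {u} {w} {v} 0<λ 0<α 0<β nd = inside nd (orient-barycentric u w v α β)
  where
  O = orient u w v
  p = barycentric v u w α β
  inside : NonDegenerate u w v →
    orient u w p ≡ (1ℚ - α - β) * O × orient w v p ≡ α * O × orient v u p ≡ β * O →
    StrictlyInside p u w v
  inside (inj₁ 0<O) (e₁ , e₂ , e₃) = inj₁
    (subst (0ℚ <_) (sym e₁) (pos*pos 0<λ 0<O) , subst (0ℚ <_) (sym e₂) (pos*pos 0<α 0<O) ,
     subst (0ℚ <_) (sym e₃) (pos*pos 0<β 0<O))
  inside (inj₂ O<0) (e₁ , e₂ , e₃) = inj₂
    (subst (_< 0ℚ) (sym e₁) (pos*neg 0<λ O<0) , subst (_< 0ℚ) (sym e₂) (pos*neg 0<α O<0) ,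
     subst (_< 0ℚ) (sym e₃) (pos*neg 0<β O<0))

convex-nonNeg : ∀ {λ′ α β a b c} → 0ℚ ≤ λ′ → 0ℚ ≤ α → 0ℚ ≤ β → 0ℚ ≤ a → 0ℚ ≤ b → 0ℚ ≤ c →
  0ℚ ≤ λ′ * a + α * b + β * c
convex-nonNeg 0≤λ 0≤α 0≤β 0≤a 0≤b 0≤c =
  nonNeg+nonNeg (nonNeg+nonNeg (nonNeg*nonNeg 0≤λ 0≤a) (nonNeg*nonNeg 0≤α 0≤b)) (nonNeg*nonNeg 0≤β 0≤c)

barycentric-inStrip : ∀ {α β u w v} → 0ℚ ≤ 1ℚ - α - β → 0ℚ ≤ α → 0ℚ ≤ β →
  InStrip u → InStrip w → InStrip v → InStrip (barycentric v u w α β)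
barycentric-inStrip {α} {β} {_ , uy} {_ , wy} {_ , vy} 0≤λ 0≤α 0≤β (inStrip 0≤uy uy≤1) (inStrip 0≤wy wy≤1) (inStrip 0≤vy vy≤1) =
  inStrip
    (subst (0ℚ ≤_) (sym (coordinate vy uy wy α β))
      (convex-nonNeg 0≤λ 0≤α 0≤β 0≤vy 0≤uy 0≤wy))
    (0≤q-p⇒p≤q (subst (0ℚ ≤_) (sym (complement vy uy wy α β))
      (convex-nonNeg 0≤λ 0≤α 0≤β (p≤q⇒0≤q-p vy≤1) (p≤q⇒0≤q-p uy≤1) (p≤q⇒0≤q-p wy≤1))))
  where
  coordinate : ∀ v u w α β → v + α * (u - v) + β * (w - v) ≡ (1ℚ - α - β) * v + α * u + β * w
  coordinate = solve 5 (λ v u w α β → v :+ α :* (u :- v) :+ β :* (w :- v)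
                                     := (con 1ℚ :- α :- β) :* v :+ α :* u :+ β :* w) refl
  complement : ∀ v u w α β → 1ℚ - (v + α * (u - v) + β * (w - v))
                           ≡ (1ℚ - α - β) * (1ℚ - v) + α * (1ℚ - u) + β * (1ℚ - w)
  complement = solve 5 (λ v u w α β → con 1ℚ :- (v :+ α :* (u :- v) :+ β :* (w :- v))
                     := (con 1ℚ :- α :- β) :* (con 1ℚ :- v) :+ α :* (con 1ℚ :- u) :+ β :* (con 1ℚ :- w)) refl

orient-rotate : ∀ a b c → orient a b c ≡ orient b c a
orient-rotate (ax , ay) (bx , by) (cx , cy) =
  solve 6 (λ ax ay bx by cx cy → let a = ax , ay; b = bx , by; c = cx , cy in
    orientₑ a b c := orientₑ b c a) refl ax ay bx by cx cy

nonDegenerate-rotate : ∀ {a b c} → NonDegenerate a b c → NonDegenerate b c a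
nonDegenerate-rotate {a} {b} {c} = subst (λ o → 0ℚ < o ⊎ o < 0ℚ) (orient-rotate a b c)

strictlyInside-rotate : ∀ {p a b c} → StrictlyInside p b c a → StrictlyInside p a b c
strictlyInside-rotate (inj₁ (bc , ca , ab)) = inj₁ (ab , bc , ca)
strictlyInside-rotate (inj₂ (bc , ca , ab)) = inj₂ (ab , bc , ca)

strictlyInside⇒nonDegenerate : ∀ {p a b c} → StrictlyInside p a b c →
  NonDegenerate a b p × NonDegenerate b c p × NonDegenerate c a p
strictlyInside⇒nonDegenerate (inj₁ (ab , bc , ca)) = inj₁ ab , inj₁ bc , inj₁ ca
strictlyInside⇒nonDegenerate (inj₂ (ab , bc , ca)) = inj₂ ab , inj₂ bc , inj₂ ca

-- The vertex inserted into a wedge with apex v and distances 1 + D₁, 1 + D₂: as α is the inverse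
-- of the sum d of these distances, it lies on the median from v at horizontal distance 1 from v.
module Median (D₁ D₂ : ℕ) where

  d : ℚ
  d = ℕtoℚ (suc D₁) + ℕtoℚ (suc D₂)

  0<d : 0ℚ < d
  0<d = pos+pos (0<ℕtoℚ-suc D₁) (0<ℕtoℚ-suc D₂)

  instance
    d≢0 : NonZero d
    d≢0 = >-nonZero 0<d

  α : ℚ
  α = 1/ d

  0<α : 0ℚ < α
  0<α = positive⁻¹ α {{1/pos⇒pos d {{positive 0<d}}}}

  1-α-α≡ : 1ℚ - α - α ≡ α * (ℕtoℚ D₁ + ℕtoℚ D₂)
  1-α-α≡ = begin
    1ℚ - α - α                                  ≡⟨ cong (λ z → z - α - α) (sym (*-inverseˡ d)) ⟩
    α * (ℕtoℚ (suc D₁) + ℕtoℚ (suc D₂)) - α - α ≡⟨ cong₂ (λ x y → α * (x + y) - α - α) (ℕtoℚ-suc D₁) (ℕtoℚ-suc D₂) ⟩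
    α * ((1ℚ + d₁) + (1ℚ + d₂)) - α - α         ≡⟨ identity α d₁ d₂ ⟩
    α * (d₁ + d₂)                               ∎
    where
    open ≡-Reasoning
    d₁ = ℕtoℚ D₁
    d₂ = ℕtoℚ D₂
    identity : ∀ α d₁ d₂ → α * ((1ℚ + d₁) + (1ℚ + d₂)) - α - α ≡ α * (d₁ + d₂)
    identity = solve 3 (λ α d₁ d₂ → α :* ((con 1ℚ :+ d₁) :+ (con 1ℚ :+ d₂)) :- α :- α
                                   := α :* (d₁ :+ d₂)) refl

  0<1-α-α : 0 ℕ.< D₁ → 0ℚ < 1ℚ - α - α
  0<1-α-α 0<D₁ = subst (0ℚ <_) (sym 1-α-α≡)
    (pos*pos 0<α (+-mono-<-≤ (ℕtoℚ-mono-< 0<D₁) (0≤ℕtoℚ D₂)))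

  median : Point → Point → Point → Point
  median u w v = barycentric v u w α α

  median-strictlyInside : ∀ {u w v} → 0 ℕ.< D₁ → NonDegenerate u w v → StrictlyInside (median u w v) u w v
  median-strictlyInside {u} {w} {v} 0<D₁ =
    barycentric-strictlyInside {α} {α} {u} {w} {v} (0<1-α-α 0<D₁) 0<α 0<α

  median-inStrip : ∀ {u w v} → 0 ℕ.< D₁ → InStrip u → InStrip w → InStrip v → InStrip (median u w v)
  median-inStrip 0<D₁ = barycentric-inStrip (<⇒≤ (0<1-α-α 0<D₁)) (<⇒≤ 0<α) (<⇒≤ 0<α)

  median-offset : ∀ {s u w v} → Offset s (suc D₁) v u → Offset s (suc D₂) v w → Offset s 1 v (median u w v)
  median-offset {s} {_ , _} {_ , _} {vx , _} (offset refl) (offset refl) = offset (begin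
    vx + α * (vx + s * e₁ - vx) + α * (vx + s * e₂ - vx) ≡⟨ identity vx s α e₁ e₂ ⟩
    vx + s * (α * (e₁ + e₂))                             ≡⟨ cong (λ z → vx + s * z) (*-inverseˡ d) ⟩
    vx + s * 1ℚ                                          ∎)
    where
    open ≡-Reasoning
    e₁ = ℕtoℚ (suc D₁)
    e₂ = ℕtoℚ (suc D₂)
    identity : ∀ v s α e₁ e₂ → v + α * (v + s * e₁ - v) + α * (v + s * e₂ - v) ≡ v + s * (α * (e₁ + e₂))
    identity = solve 5 (λ v s α e₁ e₂ → v :+ α :* (v :+ s :* e₁ :- v) :+ α :* (v :+ s :* e₂ :- v)
                                       := v :+ s :* (α :* (e₁ :+ e₂))) refl

-- v is the apex; L bounds the depth of the part of the representative tree still to be drawn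
-- inside the face.
record Wedge (W L : ℕ) (u w v : Point) : Set where
  constructor mkWedge
  field
    sign    : ℚ
    sign²   : sign * sign ≡ 1ℚ
    D₁ D₂   : ℕ
    L<D₁    : L ℕ.< D₁
    L<D₂    : L ℕ.< D₂
    D₁≤W    : D₁ ℕ.≤ W
    D₂≤W    : D₂ ℕ.≤ W
    v→u     : Offset sign D₁ v u
    v→w     : Offset sign D₂ v w
    u-strip : InStrip u
    w-strip : InStrip w
    v-strip : InStrip v

data Thin (W L : ℕ) (a b c : Point) : Set where
  apex-c : Wedge W L a b c → Thin W L a b c
  apex-a : Wedge W L b c a → Thin W L a b c
  apex-b : Wedge W L c a b → Thin W L a b c

record Split (W L : ℕ) (a b c : Point) : Set where
  field
    point  : Point
    inside : StrictlyInside point a b c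
    thin₁  : Thin W L a b point
    thin₂  : Thin W L b c point
    thin₃  : Thin W L c a point
    spoke₁ : Moderate W (a , point)
    spoke₂ : Moderate W (b , point)
    spoke₃ : Moderate W (c , point)

split-rotate : ∀ {W L a b c} → Split W L b c a → Split W L a b c
split-rotate {a = a} {b} {c} split = record
  { point  = point
  ; inside = strictlyInside-rotate {point} {a} {b} {c} inside
  ; thin₁  = thin₃
  ; thin₂  = thin₁
  ; thin₃  = thin₂
  ; spoke₁ = spoke₃
  ; spoke₂ = spoke₁
  ; spoke₃ = spoke₂
  }
  where open Split split

split-wedge : ∀ {W L u w v} → Wedge W (suc L) u w v → NonDegenerate u w v → Split W L u w v
split-wedge {W} {L} {u} {w} {v}
  (mkWedge s s² (suc D₁) (suc D₂) (s≤s L<D₁) (s≤s L<D₂) D₁<W D₂<W v→u v→w u-strip w-strip v-strip) nd = record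
  { point  = p
  ; inside = median-strictlyInside {u} {w} {v} 0<D₁ nd
  ; thin₁  = apex-c (mkWedge s s² D₁ D₂ L<D₁ L<D₂ (ℕP.<⇒≤ D₁<W) (ℕP.<⇒≤ D₂<W)
                       p→u p→w u-strip w-strip p-strip)
  ; thin₂  = apex-a (mkWedge (- s) -s² (suc D₂) D₂ (ℕP.m<n⇒m<1+n L<D₂) L<D₂ D₂<W (ℕP.<⇒≤ D₂<W)
                       (offset-sym v→w) (offset-sym p→w) v-strip p-strip w-strip)
  ; thin₃  = apex-b (mkWedge (- s) -s² D₁ (suc D₁) L<D₁ (ℕP.m<n⇒m<1+n L<D₁) (ℕP.<⇒≤ D₁<W) D₁<W
                       (offset-sym p→u) (offset-sym v→u) p-strip v-strip u-strip)
  ; spoke₁ = offset-moderate -s² 0<D₁ (ℕP.<⇒≤ D₁<W) (offset-sym p→u) u-strip p-strip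
  ; spoke₂ = offset-moderate -s² 0<D₂ (ℕP.<⇒≤ D₂<W) (offset-sym p→w) w-strip p-strip
  ; spoke₃ = offset-moderate s² (s≤s z≤n) (ℕP.≤-trans (s≤s z≤n) D₁<W) v→p v-strip p-strip
  }
  where
  open Median D₁ D₂
  -s² : - s * - s ≡ 1ℚ
  -s² = trans (solve 1 (λ s → (:- s) :* (:- s) := s :* s) refl s) s²
  0<D₁ : 0 ℕ.< D₁
  0<D₁ = ℕP.≤-trans (s≤s z≤n) L<D₁
  0<D₂ : 0 ℕ.< D₂
  0<D₂ = ℕP.≤-trans (s≤s z≤n) L<D₂
  p : Point
  p = median u w v
  p-strip : InStrip p
  p-strip = median-inStrip 0<D₁ u-strip w-strip v-strip
  v→p : Offset s 1 v p
  v→p = median-offset v→u v→w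
  p→u : Offset s D₁ p u
  p→u = offset-pred v→u v→p
  p→w : Offset s D₂ p w
  p→w = offset-pred v→w v→p

split : ∀ {W L a b c} → Thin W (suc L) a b c → NonDegenerate a b c → Split W L a b c
split (apex-c wedge) nd = split-wedge wedge nd
split {a = a} {b} {c} (apex-a wedge) nd = split-rotate (split-wedge wedge (nonDegenerate-rotate {a} {b} {c} nd))
split {a = a} {b} {c} (apex-b wedge) nd =
  split-rotate (split-rotate (split-wedge wedge (nonDegenerate-rotate {b} {c} {a} (nonDegenerate-rotate {a} {b} {c} nd))))

Drawing : ℕ → Point → Point → Point → T3 → Set
Drawing W a b c t = Σ (Placement t) λ d → Valid a b c t d × All (Moderate W) (innerEdges a b c t d)

draw : ∀ {W L a b c} t → depth t ℕ.≤ L → Thin W L a b c → NonDegenerate a b c → Drawing W a b c t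
draw leaf _ _ _ = tt , tt , []
draw {a = a} {b} {c} (node t₁ t₂ t₃) (s≤s depth≤L) thin nd =
  let open Split (split thin nd)
      nd₁ , nd₂ , nd₃ = strictlyInside⇒nonDegenerate {point} {a} {b} {c} inside
      depth₂₃≤L = ℕP.m⊔n≤o⇒n≤o (depth t₁) _ depth≤L
      d₁ , valid₁ , edges₁ = draw t₁ (ℕP.m⊔n≤o⇒m≤o (depth t₁) _ depth≤L) thin₁ nd₁
      d₂ , valid₂ , edges₂ = draw t₂ (ℕP.m⊔n≤o⇒m≤o (depth t₂) (depth t₃) depth₂₃≤L) thin₂ nd₂
      d₃ , valid₃ , edges₃ = draw t₃ (ℕP.m⊔n≤o⇒n≤o (depth t₂) (depth t₃) depth₂₃≤L) thin₃ nd₃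
  in (point , d₁ , d₂ , d₃) , (inside , valid₁ , valid₂ , valid₃) ,
     spoke₁ ∷ spoke₂ ∷ spoke₃ ∷ ++⁺ edges₁ (++⁺ edges₂ edges₃)

module OuterFace (K : ℕ) where

  far : ℚ
  far = ℕtoℚ (suc K)

  a b c : Point
  a = far , 1ℚ
  b = far , 0ℚ
  c = 0ℚ , 0ℚ

  c→a : Offset 1ℚ (suc K) c a
  c→a = offset (solve 1 (λ x → x := con 0ℚ :+ con 1ℚ :* x) refl far)

  c→b : Offset 1ℚ (suc K) c b
  c→b = offset (Offset.x-offset c→a)

  thin : Thin (suc K) K a b c
  thin = apex-c (mkWedge 1ℚ refl (suc K) (suc K) ℕP.≤-refl ℕP.≤-refl ℕP.≤-refl ℕP.≤-refl
                   c→a c→b (inStrip 0≤1 ≤-refl) (inStrip ≤-refl 0≤1) (inStrip ≤-refl 0≤1))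

  nonDegenerate : NonDegenerate a b c
  nonDegenerate = inj₂ (subst (_< 0ℚ) (sym (orient≡-far far)) (neg-antimono-< (0<ℕtoℚ-suc K)))
    where
    orient≡-far : ∀ x → (x - x) * (0ℚ - 1ℚ) - (0ℚ - 1ℚ) * (0ℚ - x) ≡ - x
    orient≡-far = solve 1 (λ x → (x :- x) :* (con 0ℚ :- con 1ℚ) :- (con 0ℚ :- con 1ℚ) :* (con 0ℚ :- x) := :- x) refl

  moderate : All (Moderate (suc K)) ((a , b) ∷ (b , c) ∷ (c , a) ∷ [])
  moderate = ab ∷ offset-moderate refl (s≤s z≤n) ℕP.≤-refl (offset-sym c→b) (inStrip ≤-refl 0≤1) (inStrip ≤-refl 0≤1)
               ∷ offset-moderate refl (s≤s z≤n) ℕP.≤-refl c→a (inStrip ≤-refl 0≤1) (inStrip 0≤1 ≤-refl) ∷ []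
    where
    sqLen-ab : ∀ x → (x - x) * (x - x) + (0ℚ - 1ℚ) * (0ℚ - 1ℚ) ≡ 1ℚ
    sqLen-ab = solve 1 (λ x → (x :- x) :* (x :- x) :+ (con 0ℚ :- con 1ℚ) :* (con 0ℚ :- con 1ℚ) := con 1ℚ) refl
    ab : Moderate (suc K) (a , b)
    ab = subst (λ z → 1ℚ ≤ z × z ≤ far * far + 1ℚ) (sym (sqLen-ab far))
           (≤-refl , subst (1ℚ ≤_) (+-comm 1ℚ (far * far)) (p≤p+q (0≤p*p far)))

depth-positive : ∀ t → 1 ℕ.≤ depth t
depth-positive leaf = s≤s z≤n
depth-positive (node _ _ _) = s≤s z≤n

ratio-bound : ∀ K → 1 ℕ.≤ K →
  ℕtoℚ (suc K) * ℕtoℚ (suc K) + 1ℚ ≤ (ℕtoℚ 3 * ℕtoℚ K) * (ℕtoℚ 3 * ℕtoℚ K) * 1ℚ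
ratio-bound K 1≤K = subst (λ f → f * f + 1ℚ ≤ (ℕtoℚ 3 * k) * (ℕtoℚ 3 * k) * 1ℚ) (sym (ℕtoℚ-suc K))
  (0≤q-p⇒p≤q (subst (0ℚ ≤_) (sym (identity k))
    (nonNeg+nonNeg (nonNeg+nonNeg (nonNeg*nonNeg (0≤ℕtoℚ 8) (0≤p*p (k - 1ℚ)))
                                  (nonNeg*nonNeg (0≤ℕtoℚ 14) 0≤k-1))
                   (0≤ℕtoℚ 4))))
  where
  k = ℕtoℚ K
  0≤k-1 : 0ℚ ≤ k - 1ℚ
  0≤k-1 = p≤q⇒0≤q-p (ℕtoℚ-mono-≤ 1≤K)
  identity : ∀ k → (ℕtoℚ 3 * k) * (ℕtoℚ 3 * k) * 1ℚ - ((1ℚ + k) * (1ℚ + k) + 1ℚ)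
                   ≡ ℕtoℚ 8 * ((k - 1ℚ) * (k - 1ℚ)) + ℕtoℚ 14 * (k - 1ℚ) + ℕtoℚ 4
  identity = solve 1 (λ k → (con (ℕtoℚ 3) :* k) :* (con (ℕtoℚ 3) :* k) :* con 1ℚ
                            :- ((con 1ℚ :+ k) :* (con 1ℚ :+ k) :+ con 1ℚ)
                          := con (ℕtoℚ 8) :* ((k :- con 1ℚ) :* (k :- con 1ℚ))
                            :+ con (ℕtoℚ 14) :* (k :- con 1ℚ) :+ con (ℕtoℚ 4)) refl

theorem2 : Σ ℚ (λ C → (0ℚ < C) ×
    ((t : T3) → Σ Point (λ a → Σ Point (λ b → Σ Point (λ c → Σ (Placement t) (λ d →
      NonDegenerate a b c × Valid a b c t d
        × RatioAtMost (C * ℕtoℚ (depth t)) (edges a b c t d)))))))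
theorem2 = ℕtoℚ 3 , 0<ℕtoℚ-suc 2 , λ t →
  let open OuterFace (depth t)
      d , valid , inner = draw t ℕP.≤-refl thin nonDegenerate
  in a , b , c , d , nonDegenerate , valid ,
     ratioAtMost (ℕtoℚ 3 * ℕtoℚ (depth t)) (ratio-bound (depth t) (depth-positive t)) (++⁺ moderate inner)
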